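{- For any graph $G\in\mathcal{G}$ (described below), every induced path in $G$ contains at most three $x$-type vertices. Moreover, if an induced path in $G$ contains three $x$-type vertices, then it has at most $15$ vertices.
   Context: Let $M'$ be the fifth Mycielski graph $M_5$ (23 vertices $u_0,\dots,u_{22}$) with $u_{16}$ deleted and vertices renamed $v_0,\dots,v_{21}$; let $I=(t_0,t_1,t_2,t_3)=(v_1,v_3,v_{10},v_{21})$ and $I'=(t_0',t_1',t_2',t_3')=(v_{19},v_{17},v_{11},v_5)$, both independent, with $t_it_j'$ an edge iff $i\ne j$. Let $H$ be the graph on $a_0,b_0,a_1,b_1,a_2,c_0,c_1,c_2$ with edges $a_0b_0,b_0a_1,a_1b_1,b_1a_2,a_0c_0,a_1c_1,a_2c_2$ (vertices of $a$-, $b$-, $c$-type). For a Monotone Not-All-Equal-3-SAT instance $\phi$ with variables $x_0,\dots,x_n$ and clauses $S_0,\dots,S_m$, $G(\phi)$ consists of $M'$, an independent set of $x$-type vertices $x_0,\dots,x_n$ each adjacent to $t_2,t_3$, and for each clause $S_j=(x_{j_0},x_{j_1},x_{j_2})$ two copies $H_0,H_1$ of $H$ with $c_h$ adjacent to $x_{j_h}$. Every $x$-type vertex is adjacent to every $b$-type vertex; every $b$-type vertex to $t_0',t_1'$; every $c$-type vertex to $t_2',t_3'$; in $H_0$ copies add $a_0t_0,a_0t_2,a_1t_0,a_2t_0,a_2t_3$, in $H_1$ copies add $a_0t_1,a_0t_2,a_1t_1,a_2t_1,a_2t_3$. $\mathcal{G}=\{G(\phi)\}$ over all instances $\phi$.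 -}

module Defs where

open import Data.Bool using (Bool; true; false; _∧_; _∨_; not; T; if_then_else_)
open import Data.Nat using (ℕ; zero; suc; _+_; _*_; _∸_; _<ᵇ_; _≡ᵇ_; _≤_)
open import Data.Fin using (Fin; toℕ; zero; suc; #_)
open import Data.List using (List; []; _∷_; length; lookup)
open import Data.Sum using (_⊎_)
open import Data.Product using (_×_)
open import Function.Bundles using (_⇔_)
open import Relation.Binary.PropositionalEquality using (_≡_)

-- Mycielski graphs M_2 = K_2, M_{k+1} = μ(M_k), on vertices u_0,…
-- Level l encodes M_{l+2}; vertices are natural numbers < mycSize l.
-- Mycielskian of a graph on u_0..u_{N-1}: new vertices u_{N+i}
-- (shadow of u_i, adjacent to the neighbours of u_i) and u_{2N}
-- (adjacent to all shadows).

mycSize : ℕ → ℕ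
mycSize zero    = 2
mycSize (suc l) = suc (2 * mycSize l)

-- adjacency for i < j (upper triangle)
mycUp : ℕ → ℕ → ℕ → Bool
mycUp zero    i j = (i ≡ᵇ 0) ∧ (j ≡ᵇ 1)
mycUp (suc l) i j =
  let N = mycSize l in
  if j <ᵇ N then mycUp l i j
  else if j <ᵇ (N + N) then (i <ᵇ N) ∧ (mycUp l i (j ∸ N) ∨ mycUp l (j ∸ N) i)
  else if j ≡ᵇ (N + N) then (N ≤ᵇ' i) ∧ (i <ᵇ (N + N))
  else false
  where
  _≤ᵇ'_ : ℕ → ℕ → Bool
  m ≤ᵇ' n = m <ᵇ suc n

mycAdj : ℕ → ℕ → ℕ → Bool
mycAdj l i j = mycUp l i j ∨ mycUp l j i

-- M_5 (23 vertices u_0..u_22) is level 3.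
-- M' = M_5 - u_16, with v_i = u_i (i < 16), v_i = u_{i+1} (i ≥ 16).
renameM' : Fin 22 → ℕ
renameM' v = if toℕ v <ᵇ 16 then toℕ v else suc (toℕ v)

adjM' : Fin 22 → Fin 22 → Bool
adjM' v w = mycAdj 3 (renameM' v) (renameM' w)

t0 t1 t2 t3 t0' t1' t2' t3' : Fin 22
t0  = # 1
t1  = # 3
t2  = # 10
t3  = # 21
t0' = # 19
t1' = # 17
t2' = # 11
t3' = # 5

eqF : ∀ {k} → Fin k → Fin k → Bool
eqF i j = toℕ i ≡ᵇ toℕ j

-- The gadget H: a_0 b_0 a_1 b_1 a_2 (a path) with pendants c_h at a_h.

data HV : Set where
  a : Fin 3 → HV
  b : Fin 2 → HV
  c : Fin 3 → HV

-- Vertices of G(φ) for an instance with variables x_0..x_n and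
-- clauses S_0..S_m; H-vertices are indexed by (clause j, copy k ∈ {0,1}).

data V (n m : ℕ) : Set where
  mv : Fin 22 → V n m
  xv : Fin (suc n) → V n m
  hv : Fin (suc m) → Fin 2 → HV → V n m

-- Monotone NAE-3-SAT instance: clause j is (x_{j_0}, x_{j_1}, x_{j_2}),
-- three distinct variables.
Clauses : ℕ → ℕ → Set
Clauses n m = Fin (suc m) → Fin 3 → Fin (suc n)

ValidClauses : ∀ {n m} → Clauses n m → Set
ValidClauses cl = ∀ j h h' → cl j h ≡ cl j h' → h ≡ h'

attach : Fin 2 → Fin 3 → Fin 22 → Bool
attach zero       zero             t = eqF t t0 ∨ eqF t t2
attach zero       (suc zero)       t = eqF t t0
attach zero       (suc (suc zero)) t = eqF t t0 ∨ eqF t t3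
attach (suc zero) zero             t = eqF t t1 ∨ eqF t t2
attach (suc zero) (suc zero)       t = eqF t t1
attach (suc zero) (suc (suc zero)) t = eqF t t1 ∨ eqF t t3

hEdge : HV → HV → Bool
hEdge (a i) (b i') = (toℕ i ≡ᵇ toℕ i') ∨ (toℕ i ≡ᵇ suc (toℕ i'))
hEdge (a i) (c i') = eqF i i'
hEdge _     _      = false

-- directed edge generator; adjacency is its symmetrisation
E : ∀ {n m} → Clauses n m → V n m → V n m → Bool
E cl (mv v) (mv w) = adjM' v w
E cl (xv i) (mv t) = eqF t t2 ∨ eqF t t3
E cl (xv i) (hv j k (b _)) = true
E cl (xv i) (hv j k (c h)) = eqF (cl j h) i
E cl (hv j k (b _)) (mv t) = eqF t t0' ∨ eqF t t1'
E cl (hv j k (c _)) (mv t) = eqF t t2' ∨ eqF t t3'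
E cl (hv j k (a i)) (mv t) = attach k i t
E cl (hv j k p) (hv j' k' q) = eqF j j' ∧ eqF k k' ∧ hEdge p q
E cl _ _ = false

Adj : ∀ {n m} → Clauses n m → V n m → V n m → Set
Adj cl u w = T (E cl u w ∨ E cl w u)

record IsInducedPath {n m : ℕ} (cl : Clauses n m) (p : List (V n m)) : Set where
  field
    distinct : ∀ i j → lookup p i ≡ lookup p j → i ≡ j
    adjacency : ∀ i j →
      Adj cl (lookup p i) (lookup p j) ⇔ (suc (toℕ i) ≡ toℕ j ⊎ suc (toℕ j) ≡ toℕ i)

isX : ∀ {n m} → V n m → Bool
isX (xv _) = true
isX _      = false

countX : ∀ {n m} → List (V n m) → ℕ
countX []       = 0
countX (v ∷ vs) = if isX v then suc (countX vs) else countX vs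

{-# OPTIONS --safe #-}
module Submission where

-- The vertices t₂, t₃ and all b-vertices are adjacent to every x-vertex, so an induced path
-- through three x-vertices avoids them; hence every path-neighbour of an x-vertex is a c-vertex,
-- t₂′ and t₃′ (adjacent to all c-vertices) are avoided as well, and leaving an x-vertex in either
-- direction the path is forced along x, c_h, a_h and then t₀ or t₁. With only two such end
-- vertices available, a fourth x-vertex is impossible, consecutive x-vertices are exactly 6 apart,
-- and the path has at most one vertex before the first and after the last x-vertex: at most
-- 1 + 13 + 1 = 15 vertices.

open import Defs
open import Data.Bool using (Bool; true; false; _∨_; _∧_; T; if_then_else_)
open import Data.Bool.Properties using (T-∨; T-∧; ∨-identityʳ)
open import Data.Empty using (⊥; ⊥-elim)
open import Data.Fin using (Fin; toℕ; zero; suc; fromℕ<)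
open import Data.Fin.Properties using (toℕ-injective; toℕ<n; toℕ-fromℕ<)
open import Data.List using (List; []; _∷_; length; lookup; map)
open import Data.List.Properties using (length-map)
open import Data.List.Relation.Unary.All as All using (All; []; _∷_)
open import Data.List.Relation.Unary.All.Properties as All using ()
open import Data.List.Relation.Unary.Linked as Linked using (Linked; []; [-]; _∷_)
open import Data.List.Relation.Unary.Linked.Properties as Linked using ()
open import Data.Nat using (ℕ; suc; _+_; _≤_; _<_; z≤n; s≤s; s<s; z<s)
open import Data.Nat.Properties
open import Data.Product using (_×_; _,_; ∃; map₂)
open import Data.Sum as Sum using (_⊎_; inj₁; inj₂)
open import Data.Unit using (tt)
open import Function using (_∘_)
open import Function.Bundles using (_⇔_; Equivalence)
open import Relation.Nullary using (¬_)
open import Relation.Binary.PropositionalEquality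
  using (_≡_; _≢_; refl; sym; trans; cong; subst; ≢-sym)

private
  variable
    A : Set
    n i j k l r : ℕ

_∼_ : ℕ → ℕ → Set
i ∼ j = suc i ≡ j ⊎ suc j ≡ i

∼-sym : i ∼ j → j ∼ i
∼-sym = Sum.swap

∼⇒≤1+ : i ∼ j → j ≤ suc i
∼⇒≤1+ (inj₁ refl) = ≤-refl
∼⇒≤1+ {j = j} (inj₂ refl) = m≤n+m j 2

∼-around : k ∼ i → k ∼ j → i < j → suc i ≡ k × suc k ≡ j
∼-around (inj₁ refl) (inj₁ refl) i<j = ⊥-elim (<-irrefl refl i<j)
∼-around {j = j} (inj₁ refl) (inj₂ refl) i<j = ⊥-elim (<⇒≱ i<j (m≤n+m j 2))
∼-around (inj₂ refl) (inj₁ refl) _ = refl , refl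
∼-around (inj₂ refl) (inj₂ refl) i<j = ⊥-elim (<-irrefl refl i<j)

¬three-∼ : ∀ {j₁ j₂ j₃} → k ∼ j₁ → k ∼ j₂ → k ∼ j₃ → j₁ < j₂ → j₂ < j₃ → ⊥
¬three-∼ k∼j₁ k∼j₂ k∼j₃ j₁<j₂ j₂<j₃
  with ∼-around k∼j₁ k∼j₂ j₁<j₂ | ∼-around k∼j₂ k∼j₃ j₂<j₃
... | _ , refl | () , _

_[_]=_ : List A → ℕ → A → Set
p [ i ]= v = ∃ λ (f : Fin (length p)) → toℕ f ≡ i × lookup p f ≡ v

[]=-here : ∀ {v : A} {p} → (v ∷ p) [ 0 ]= v
[]=-here = zero , refl , refl

[]=-there : ∀ {u v : A} {p} → p [ i ]= v → (u ∷ p) [ suc i ]= v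
[]=-there (f , refl , e) = suc f , refl , e

module InducedPath {V : Set} (Adj : V → V → Set) (p : List V)
  (distinct : ∀ f g → lookup p f ≡ lookup p g → f ≡ g)
  (adjacency : ∀ f g → Adj (lookup p f) (lookup p g) ⇔ toℕ f ∼ toℕ g)
  where

  private
    variable
      u v w u₁ u₂ u₃ : V

  at-injective : p [ i ]= v → p [ j ]= v → i ≡ j
  at-injective (f , refl , refl) (g , refl , g↦v) = cong toℕ (distinct f g (sym g↦v))

  at-<length : p [ i ]= v → i < length p
  at-<length (f , refl , _) = toℕ<n f

  vertex-at : i < length p → ∃ (p [ i ]=_)
  vertex-at i<len = _ , fromℕ< i<len , toℕ-fromℕ< i<len , refl

  vertex-below : ∀ d → p [ d + i ]= v → ∃ (p [ i ]=_)
  vertex-below {i} d e = vertex-at (≤-<-trans (m≤n+m i d) (at-<length e))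

  adj⇒∼ : p [ i ]= u → p [ j ]= w → Adj u w → i ∼ j
  adj⇒∼ (f , refl , refl) (g , refl , refl) = Equivalence.to (adjacency f g)

  ∼⇒adj : p [ i ]= u → p [ j ]= w → i ∼ j → Adj u w
  ∼⇒adj (f , refl , refl) (g , refl , refl) = Equivalence.from (adjacency f g)

  ¬three-neighbours : ∀ {j₁ j₂ j₃} → p [ k ]= w →
    p [ j₁ ]= u₁ → p [ j₂ ]= u₂ → p [ j₃ ]= u₃ → j₁ < j₂ → j₂ < j₃ →
    Adj w u₁ → Adj w u₂ → Adj w u₃ → ⊥
  ¬three-neighbours e e₁ e₂ e₃ j₁<j₂ j₂<j₃ w~u₁ w~u₂ w~u₃ =
    ¬three-∼ (adj⇒∼ e e₁ w~u₁) (adj⇒∼ e e₂ w~u₂) (adj⇒∼ e e₃ w~u₃) j₁<j₂ j₂<j₃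

eqF⇒≡ : (x y : Fin n) → T (eqF x y) → x ≡ y
eqF⇒≡ x y = toℕ-injective ∘ ≡ᵇ⇒≡ (toℕ x) (toℕ y)

eqF-∨⇒≡ : (s t t′ : Fin n) → T (eqF s t ∨ eqF s t′) → s ≡ t ⊎ s ≡ t′
eqF-∨⇒≡ s t t′ = Sum.map (eqF⇒≡ s t) (eqF⇒≡ s t′) ∘ Equivalence.to T-∨

T-∧₃ : ∀ {x y z} → T (x ∧ y ∧ z) → T x × T y × T z
T-∧₃ = map₂ (Equivalence.to T-∧) ∘ Equivalence.to T-∧

T-∨-false : ∀ {x} → T (x ∨ false) → T x
T-∨-false {x} = subst T (∨-identityʳ x)

module _ {n m : ℕ} where

  data AdjToAllX : V n m → Set where
    t₂ : AdjToAllX (mv t2)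
    t₃ : AdjToAllX (mv t3)
    b-vertex : ∀ j k i → AdjToAllX (hv j k (b i))

  data AdjToAllC : V n m → Set where
    t₂′ : AdjToAllC (mv t2')
    t₃′ : AdjToAllC (mv t3')

  data IsC : V n m → Set where
    c-vertex : ∀ j k h → IsC (hv j k (c h))

  data IsT₀₁ : V n m → Set where
    t₀ : IsT₀₁ (mv t0)
    t₁ : IsT₀₁ (mv t1)

  data Pendant : V n m → V n m → Set where
    pendant : ∀ j k h → Pendant (hv j k (c h)) (hv j k (a h))

  t₀₁-either : ∀ {u v w} → IsT₀₁ u → IsT₀₁ v → u ≢ v → IsT₀₁ w → w ≡ u ⊎ w ≡ v
  t₀₁-either t₀ t₀ u≢v _  = ⊥-elim (u≢v refl)
  t₀₁-either t₁ t₁ u≢v _  = ⊥-elim (u≢v refl)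
  t₀₁-either t₀ t₁ _   t₀ = inj₁ refl
  t₀₁-either t₀ t₁ _   t₁ = inj₂ refl
  t₀₁-either t₁ t₀ _   t₀ = inj₂ refl
  t₀₁-either t₁ t₀ _   t₁ = inj₁ refl

  attach-target : ∀ k h {t} → T (attach k h t) → AdjToAllX (mv t) ⊎ IsT₀₁ (mv t)
  attach-target zero zero {t} e with eqF-∨⇒≡ t t0 t2 e
  ... | inj₁ refl = inj₂ t₀
  ... | inj₂ refl = inj₁ t₂
  attach-target zero (suc zero) {t} e with eqF⇒≡ t t0 e
  ... | refl = inj₂ t₀
  attach-target zero (suc (suc zero)) {t} e with eqF-∨⇒≡ t t0 t3 e
  ... | inj₁ refl = inj₂ t₀
  ... | inj₂ refl = inj₁ t₃
  attach-target (suc zero) zero {t} e with eqF-∨⇒≡ t t1 t2 e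
  ... | inj₁ refl = inj₂ t₁
  ... | inj₂ refl = inj₁ t₂
  attach-target (suc zero) (suc zero) {t} e with eqF⇒≡ t t1 e
  ... | refl = inj₂ t₁
  attach-target (suc zero) (suc (suc zero)) {t} e with eqF-∨⇒≡ t t1 t3 e
  ... | inj₁ refl = inj₂ t₁
  ... | inj₂ refl = inj₁ t₃

module _ {n m : ℕ} (cl : Clauses n m) where

  E-hv : ∀ {j j′ k k′} q q′ → E cl (hv j k q) (hv j′ k′ q′) ≡ (eqF j j′ ∧ eqF k k′ ∧ hEdge q q′)
  E-hv (a _) _ = refl
  E-hv (b _) _ = refl
  E-hv (c _) _ = refl

  same-copy : ∀ j k q j′ k′ q′ → Adj cl (hv j k q) (hv j′ k′ q′) →
    j ≡ j′ × k ≡ k′ × T (hEdge q q′ ∨ hEdge q′ q)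
  same-copy j k q j′ k′ q′ e with Equivalence.to T-∨ e
  ... | inj₁ e′ with T-∧₃ (subst T (E-hv q q′) e′)
  ...   | j≡j′ , k≡k′ , q~q′ =
    eqF⇒≡ j j′ j≡j′ , eqF⇒≡ k k′ k≡k′ , Equivalence.from T-∨ (inj₁ q~q′)
  same-copy j k q j′ k′ q′ e | inj₂ e′ with T-∧₃ (subst T (E-hv q′ q) e′)
  ...   | j′≡j , k′≡k , q′~q =
    sym (eqF⇒≡ j′ j j′≡j) , sym (eqF⇒≡ k′ k k′≡k) , Equivalence.from T-∨ (inj₂ q′~q)

  adjToAllX-adj : ∀ {w i} → AdjToAllX w → Adj cl w (xv i)
  adjToAllX-adj t₂ = tt
  adjToAllX-adj t₃ = tt
  adjToAllX-adj (b-vertex _ _ _) = tt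

  adjToAllC-adj : ∀ {w u} → AdjToAllC w → IsC u → Adj cl w u
  adjToAllC-adj t₂′ (c-vertex _ _ _) = tt
  adjToAllC-adj t₃′ (c-vertex _ _ _) = tt

  x-neighbour : ∀ {α w} → Adj cl (xv α) w → AdjToAllX w ⊎ IsC w
  x-neighbour {w = mv t} e with eqF-∨⇒≡ t t2 t3 (T-∨-false e)
  ... | inj₁ refl = inj₁ t₂
  ... | inj₂ refl = inj₁ t₃
  x-neighbour {w = hv _ _ (b _)} _ = inj₁ (b-vertex _ _ _)
  x-neighbour {w = hv _ _ (c _)} _ = inj₂ (c-vertex _ _ _)

  c-has-one-x : ∀ α β {w} → IsC w → Adj cl (xv α) w → Adj cl (xv β) w → α ≡ β
  c-has-one-x α β (c-vertex j _ h) e e′ =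
    trans (sym (eqF⇒≡ (cl j h) α (T-∨-false e))) (eqF⇒≡ (cl j h) β (T-∨-false e′))

  c-neighbour : ∀ {j k h u} → Adj cl (hv j k (c h)) u →
    (∃ λ β → u ≡ xv β) ⊎ Pendant (hv j k (c h)) u ⊎ AdjToAllC u
  c-neighbour {u = mv t} e with eqF-∨⇒≡ t t2' t3' (T-∨-false e)
  ... | inj₁ refl = inj₂ (inj₂ t₂′)
  ... | inj₂ refl = inj₂ (inj₂ t₃′)
  c-neighbour {u = xv β} _ = inj₁ (β , refl)
  c-neighbour {j} {k} {h} {hv j′ k′ (a h′)} e with same-copy j k (c h) j′ k′ (a h′) e
  ... | refl , refl , h′≡h with eqF⇒≡ h′ h h′≡h
  ...   | refl = inj₂ (inj₁ (pendant _ _ _))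
  c-neighbour {j} {k} {h} {hv j′ k′ (b i)} e with same-copy j k (c h) j′ k′ (b i) e
  ... | _ , _ , ()
  c-neighbour {j} {k} {h} {hv j′ k′ (c h′)} e with same-copy j k (c h) j′ k′ (c h′) e
  ... | _ , _ , ()

  a-neighbour : ∀ {j k h u} → Adj cl (hv j k (a h)) u →
    AdjToAllX u ⊎ u ≡ hv j k (c h) ⊎ IsT₀₁ u
  a-neighbour {k = k} {h} {mv t} e with attach-target k h (T-∨-false e)
  ... | inj₁ hub = inj₁ hub
  ... | inj₂ τ = inj₂ (inj₂ τ)
  a-neighbour {u = hv _ _ (b _)} _ = inj₁ (b-vertex _ _ _)
  a-neighbour {j} {k} {h} {hv j′ k′ (c h′)} e with same-copy j k (a h) j′ k′ (c h′) e
  ... | refl , refl , h≡h′ with eqF⇒≡ h h′ (T-∨-false h≡h′)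
  ...   | refl = inj₂ (inj₁ refl)
  a-neighbour {j} {k} {h} {hv j′ k′ (a h′)} e with same-copy j k (a h) j′ k′ (a h′) e
  ... | _ , _ , ()

  a-adj-t₀₁ : ∀ j k h → ∃ λ u → IsT₀₁ u × Adj cl (hv j k (a h)) u
  a-adj-t₀₁ _ zero       zero             = _ , t₀ , tt
  a-adj-t₀₁ _ zero       (suc zero)       = _ , t₀ , tt
  a-adj-t₀₁ _ zero       (suc (suc zero)) = _ , t₀ , tt
  a-adj-t₀₁ _ (suc zero) zero             = _ , t₁ , tt
  a-adj-t₀₁ _ (suc zero) (suc zero)       = _ , t₁ , tt
  a-adj-t₀₁ _ (suc zero) (suc (suc zero)) = _ , t₁ , tt

module ThroughThreeX {n m : ℕ} {cl : Clauses n m} {p : List (V n m)} (ip : IsInducedPath cl p)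
  {i₁ i₂ i₃ : ℕ} {α₁ α₂ α₃ : Fin (suc n)}
  (x₁ : p [ i₁ ]= xv α₁) (x₂ : p [ i₂ ]= xv α₂) (x₃ : p [ i₃ ]= xv α₃)
  (i₁<i₂ : i₁ < i₂) (i₂<i₃ : i₂ < i₃)
  where

  open IsInducedPath ip
  open InducedPath (Adj cl) p distinct adjacency

  private
    variable
      α β : Fin (suc n)
      w w₁ w₂ w₃ : V n m

  no-adjToAllX : p [ k ]= w → ¬ AdjToAllX w
  no-adjToAllX e hub = ¬three-neighbours e x₁ x₂ x₃ i₁<i₂ i₂<i₃
    (adjToAllX-adj cl hub) (adjToAllX-adj cl hub) (adjToAllX-adj cl hub)

  c-beside-x : p [ i ]= xv α → p [ j ]= w → i ∼ j → IsC w
  c-beside-x x e i∼j with x-neighbour cl (∼⇒adj x e i∼j)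
  ... | inj₁ hub = ⊥-elim (no-adjToAllX e hub)
  ... | inj₂ isC = isC

  x-gap : p [ i ]= xv α → p [ j ]= xv β → i < j → 3 + i ≤ j
  x-gap {i} {α} {j} {β} x y i<j = ≤∧≢⇒< (≤∧≢⇒< i<j 1+i≢j) 2+i≢j
    where
    1+i≢j : suc i ≢ j
    1+i≢j refl with c-beside-x x y (inj₁ refl)
    ... | ()

    2+i≢j : 2 + i ≢ j
    2+i≢j refl with vertex-below 1 y
    ... | _ , e with c-beside-x x e (inj₁ refl)
    ...   | isC with c-has-one-x cl α β isC (∼⇒adj x e (inj₁ refl)) (∼⇒adj y e (inj₂ refl))
    ...     | refl = m≢1+n+m i (at-injective x y)

  no-adjToAllC : p [ k ]= w → ¬ AdjToAllC w
  no-adjToAllC e hub with m≤n⇒∃[o]m+o≡n (x-gap x₂ x₃ i₂<i₃)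
  ... | r , refl with vertex-at (≤-<-trans i₁<i₂ (at-<length x₂))
                    | vertex-at (≤-<-trans i₂<i₃ (at-<length x₃))
                    | vertex-below 1 x₃
  ...   | _ , c₁ | _ , c₂ | _ , c₃ =
    ¬three-neighbours e c₁ c₂ c₃ (s<s i₁<i₂) (s<s (s≤s (m≤m+n i₂ r)))
      (adjToAllC-adj cl hub (c-beside-x x₁ c₁ (inj₁ refl)))
      (adjToAllC-adj cl hub (c-beside-x x₂ c₂ (inj₁ refl)))
      (adjToAllC-adj cl hub (c-beside-x x₃ c₃ (inj₂ refl)))

  pendant-from-x : p [ i ]= xv α → p [ j ]= w₁ → p [ k ]= w₂ →
    i ∼ j → j ∼ k → i ≢ k → Pendant w₁ w₂
  pendant-from-x {α = α} x e₁ e₂ i∼j j∼k i≢k with c-beside-x x e₁ i∼j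
  ... | isC@(c-vertex _ _ _) with c-neighbour cl (∼⇒adj e₁ e₂ j∼k)
  ...   | inj₂ (inj₁ pend) = pend
  ...   | inj₂ (inj₂ hub) = ⊥-elim (no-adjToAllC e₂ hub)
  ...   | inj₁ (β , refl) with c-has-one-x cl α β isC (∼⇒adj x e₁ i∼j) (∼⇒adj e₂ e₁ (∼-sym j∼k))
  ...     | refl = ⊥-elim (i≢k (at-injective x e₂))

  t₀₁-from-x : p [ i ]= xv α → p [ j ]= w₁ → p [ k ]= w₂ → p [ l ]= w₃ →
    i ∼ j → j ∼ k → k ∼ l → i ≢ k → j ≢ l → IsT₀₁ w₃
  t₀₁-from-x x e₁ e₂ e₃ i∼j j∼k k∼l i≢k j≢l with pendant-from-x x e₁ e₂ i∼j j∼k i≢k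
  ... | pendant _ _ _ with a-neighbour cl (∼⇒adj e₂ e₃ k∼l)
  ...   | inj₁ hub = ⊥-elim (no-adjToAllX e₃ hub)
  ...   | inj₂ (inj₁ refl) = ⊥-elim (j≢l (at-injective e₁ e₃))
  ...   | inj₂ (inj₂ τ) = τ

  t₀₁-after-x : p [ i ]= xv α → 3 + i < length p → ∃ λ w → p [ 3 + i ]= w × IsT₀₁ w
  t₀₁-after-x {i} x 3+i<len with vertex-at 3+i<len
  ... | w , e₃ with vertex-below 2 e₃ | vertex-below 1 e₃
  ...   | _ , e₁ | _ , e₂ = w , e₃ ,
    t₀₁-from-x x e₁ e₂ e₃ (inj₁ refl) (inj₁ refl) (inj₁ refl) (m≢1+n+m i) (m≢1+n+m (suc i) {1})

  t₀₁-before-x : p [ 3 + i ]= xv α → ∃ λ w → p [ i ]= w × IsT₀₁ w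
  t₀₁-before-x {i} x with vertex-below 1 x | vertex-below 2 x | vertex-below 3 x
  ... | _ , e₁ | _ , e₂ | w , e₃ = w , e₃ ,
    t₀₁-from-x x e₁ e₂ e₃ (inj₂ refl) (inj₂ refl) (inj₂ refl)
      (≢-sym (m≢1+n+m (suc i) {1})) (≢-sym (m≢1+n+m i))

  t₀₁-on-path : IsT₀₁ w → p [ 3 + i₁ ]= w ⊎ p [ 3 + i₂ ]= w
  t₀₁-on-path τ
    with t₀₁-after-x x₁ (≤-<-trans (x-gap x₁ x₂ i₁<i₂) (at-<length x₂))
       | t₀₁-after-x x₂ (≤-<-trans (x-gap x₂ x₃ i₂<i₃) (at-<length x₃))
  ... | _ , e₁ , τ₁ | _ , e₂ , τ₂
    with t₀₁-either τ₁ τ₂ (λ { refl → <⇒≢ (s<s (s<s (s<s i₁<i₂))) (at-injective e₁ e₂) }) τ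
  ...   | inj₁ refl = inj₁ e₁
  ...   | inj₂ refl = inj₂ e₂

  t₀₁-position : p [ r ]= w → IsT₀₁ w → r ≡ 3 + i₁ ⊎ r ≡ 3 + i₂
  t₀₁-position e τ = Sum.map (at-injective e) (at-injective e) (t₀₁-on-path τ)

  no-fourth-x : p [ i ]= xv α → i₃ < i → ⊥
  no-fourth-x x i₃<i with t₀₁-after-x x₃ (≤-<-trans (x-gap x₃ x i₃<i) (at-<length x))
  ... | _ , e , τ with t₀₁-position e τ
  ...   | inj₁ eq = <⇒≢ (s<s (s<s (s<s (<-trans i₁<i₂ i₂<i₃)))) (sym eq)
  ...   | inj₂ eq = <⇒≢ (s<s (s<s (s<s i₂<i₃))) (sym eq)

  x-after-x₁ : p [ i ]= xv α → i₁ < i → i ≡ 6 + i₁ ⊎ i ≡ 6 + i₂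
  x-after-x₁ x i₁<i with m≤n⇒∃[o]m+o≡n (≤-trans (m≤m+n 3 i₁) (x-gap x₁ x i₁<i))
  ... | _ , refl with t₀₁-before-x x
  ...   | _ , e , τ = Sum.map (cong (3 +_)) (cong (3 +_)) (t₀₁-position e τ)

  i₂≡6+i₁ : i₂ ≡ 6 + i₁
  i₂≡6+i₁ with x-after-x₁ x₂ i₁<i₂
  ... | inj₁ eq = eq
  ... | inj₂ eq = ⊥-elim (m≢1+n+m i₂ eq)

  i₃≡6+i₂ : i₃ ≡ 6 + i₂
  i₃≡6+i₂ with x-after-x₁ x₃ (<-trans i₁<i₂ i₂<i₃)
  ... | inj₁ eq = ⊥-elim (<⇒≢ i₂<i₃ (trans i₂≡6+i₁ (sym eq)))
  ... | inj₂ eq = eq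

  a-near-t₀₁ : ∀ {j k h} → p [ r ]= hv j k (a h) → ∃ λ q → r ∼ q × 3 + i₁ ≤ q × q ≤ 3 + i₂
  a-near-t₀₁ {j = j} {k} {h} e with a-adj-t₀₁ cl j k h
  ... | _ , τ , adj with t₀₁-on-path τ
  ...   | inj₁ e′ = _ , adj⇒∼ e e′ adj , ≤-refl , +-monoʳ-≤ 3 (<⇒≤ i₁<i₂)
  ...   | inj₂ e′ = _ , adj⇒∼ e e′ adj , +-monoʳ-≤ 3 (<⇒≤ i₁<i₂) , ≤-refl

  x₁-near-start : i₁ ≤ 1
  x₁-near-start = ≮⇒≥ 2≰i₁
    where
    2≰i₁ : ¬ 2 ≤ i₁
    2≰i₁ 2≤i₁ with m≤n⇒∃[o]m+o≡n 2≤i₁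
    ... | r , refl with vertex-below 1 x₁ | vertex-below 2 x₁
    ...   | _ , e₁ | _ , e₀ with pendant-from-x x₁ e₁ e₀ (inj₂ refl) (inj₂ refl) (≢-sym (m≢1+n+m r))
    ...     | pendant _ _ _ with a-near-t₀₁ e₀
    ...       | _ , r∼q , 5+r≤q , _ = <⇒≱ (≤-trans (m≤n+m (2 + r) 3) 5+r≤q) (∼⇒≤1+ r∼q)

  x₃-near-end : length p ≤ 2 + i₃
  x₃-near-end = ≮⇒≥ 2+i₃≮length
    where
    2+i₃≮length : ¬ 2 + i₃ < length p
    2+i₃≮length 2+i₃<length with vertex-at 2+i₃<length
    ... | _ , e₂ with vertex-below 1 e₂
    ...   | _ , e₁ with pendant-from-x x₃ e₁ e₂ (inj₁ refl) (inj₁ refl) (m≢1+n+m i₃)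
    ...     | pendant _ _ _ with a-near-t₀₁ e₂
    ...       | _ , 2+i₃∼q , _ , q≤3+i₂ =
      <⇒≱ (+-monoʳ-≤ 2 (x-gap x₂ x₃ i₂<i₃)) (≤-trans (∼⇒≤1+ (∼-sym 2+i₃∼q)) (s≤s q≤3+i₂))

  length≤15 : length p ≤ 15
  length≤15 = begin
    length p  ≤⟨ x₃-near-end ⟩
    2 + i₃    ≡⟨ cong (2 +_) (trans i₃≡6+i₂ (cong (6 +_) i₂≡6+i₁)) ⟩
    14 + i₁   ≤⟨ +-monoʳ-≤ 14 x₁-near-start ⟩
    15        ∎
    where open ≤-Reasoning

positions : (A → Bool) → List A → List ℕ
positions f [] = []
positions f (v ∷ vs) =
  if f v then 0 ∷ map suc (positions f vs) else map suc (positions f vs)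

TrueAt : (A → Bool) → List A → ℕ → Set
TrueAt f vs i = ∃ λ v → vs [ i ]= v × T (f v)

module _ (f : A → Bool) where

  shift-trueAt : ∀ {u vs is} → All (TrueAt f vs) is → All (TrueAt f (u ∷ vs)) (map suc is)
  shift-trueAt = All.map⁺ ∘ All.map (λ (v , e , fv) → v , []=-there e , fv)

  positions-trueAt : ∀ vs → All (TrueAt f vs) (positions f vs)
  positions-trueAt [] = []
  positions-trueAt (v ∷ vs) with f v in fv≡
  ... | true  = (v , []=-here , subst T (sym fv≡) tt) ∷ shift-trueAt (positions-trueAt vs)
  ... | false = shift-trueAt (positions-trueAt vs)

  shift-increasing : ∀ {is} → Linked _<_ is → Linked _<_ (map suc is)
  shift-increasing = Linked.map⁺ ∘ Linked.map s<s

  positions-increasing : ∀ vs → Linked _<_ (positions f vs)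
  positions-increasing [] = []
  positions-increasing (v ∷ vs) with f v | shift-increasing (positions-increasing vs)
  ... | false | increasing = increasing
  ... | true  | increasing with positions f vs
  ...   | []    = [-]
  ...   | _ ∷ _ = z<s ∷ increasing

length-positions-isX : ∀ {n m} (vs : List (V n m)) → length (positions isX vs) ≡ countX vs
length-positions-isX [] = refl
length-positions-isX (v ∷ vs) with isX v
... | true  = cong suc (trans (length-map suc (positions isX vs)) (length-positions-isX vs))
... | false = trans (length-map suc (positions isX vs)) (length-positions-isX vs)

XAt : ∀ {n m} → List (V n m) → ℕ → Set
XAt p i = ∃ λ α → p [ i ]= xv α

trueAt-isX : ∀ {n m} {p : List (V n m)} → TrueAt isX p i → XAt p i
trueAt-isX (xv α , e , _) = α , e

module _ {n m : ℕ} {cl : Clauses n m} {p : List (V n m)} (ip : IsInducedPath cl p) where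

  x-positions-≤3 : ∀ {is} → All (XAt p) is → Linked _<_ is → length is ≤ 3
  x-positions-≤3 [] _ = z≤n
  x-positions-≤3 (_ ∷ []) _ = s≤s z≤n
  x-positions-≤3 (_ ∷ _ ∷ []) _ = s≤s (s≤s z≤n)
  x-positions-≤3 (_ ∷ _ ∷ _ ∷ []) _ = s≤s (s≤s (s≤s z≤n))
  x-positions-≤3 ((_ , x₁) ∷ (_ , x₂) ∷ (_ , x₃) ∷ (_ , x₄) ∷ _) (i₁<i₂ ∷ i₂<i₃ ∷ i₃<i₄ ∷ _) =
    ⊥-elim (ThroughThreeX.no-fourth-x ip x₁ x₂ x₃ i₁<i₂ i₂<i₃ x₄ i₃<i₄)

  three-x-positions⇒length≤15 : ∀ {is} → All (XAt p) is → Linked _<_ is →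
    length is ≡ 3 → length p ≤ 15
  three-x-positions⇒length≤15 ((_ , x₁) ∷ (_ , x₂) ∷ (_ , x₃) ∷ []) (i₁<i₂ ∷ i₂<i₃ ∷ _) _ =
    ThroughThreeX.length≤15 ip x₁ x₂ x₃ i₁<i₂ i₂<i₃
  three-x-positions⇒length≤15 [] _ ()
  three-x-positions⇒length≤15 (_ ∷ []) _ ()
  three-x-positions⇒length≤15 (_ ∷ _ ∷ []) _ ()
  three-x-positions⇒length≤15 (_ ∷ _ ∷ _ ∷ _ ∷ _) _ ()

lemma2 : (n m : ℕ) (cl : Clauses n m) → ValidClauses cl →
    (p : List (V n m)) → IsInducedPath cl p →
    (countX p ≤ 3) × (countX p ≡ 3 → length p ≤ 15)
lemma2 n m cl _ p ip =
  subst (_≤ 3) (length-positions-isX p) (x-positions-≤3 ip xs-at xs-increasing) ,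
  three-x-positions⇒length≤15 ip xs-at xs-increasing ∘ trans (length-positions-isX p)
  where
  xs-at : All (XAt p) (positions isX p)
  xs-at = All.map (trueAt-isX {p = p}) (positions-trueAt isX p)

  xs-increasing : Linked _<_ (positions isX p)
  xs-increasing = positions-increasing isX p
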